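{- Let $\lambda\in\mathbb{R}^n$ and $\sigma=(C_1,\dots,C_k)\in\mathcal{P}(\lambda)$, and suppose $C_j$ has at least two elements. Let $a\in C_j$ satisfy $\lambda_a=\max_{b\in C_j}\lambda_b$, and let $$\sigma'=(C_1,\dots,C_{j-1},\{a\},C_j-\{a\},C_{j+1},\dots,C_k).$$ Then $\sigma'\prec\sigma$ is a cover relation in $\Pi^{\mathrm{ord}}_n$, and $\sigma'\in\mathcal{P}(\lambda)$.
   Context: $\lambda_S=\sum_{i\in S}\lambda_i$. $\Pi^{\mathrm{ord}}_n$ is the set of ordered partitions of $[n]$ (lists of nonempty pairwise disjoint sets with union $[n]$). It is partially ordered by the cover relations $(C_1,\dots,C_i,C_{i+1},\dots,C_k)\prec(C_1,\dots,C_i\cup C_{i+1},\dots,C_k)$. $\mathcal{P}(\lambda)$ is the set of ordered partitions $(C_1,\dots,C_k)$ with $\sum_{i=1}^j\lambda_{C_i}>0$ for all $1\le j\le k$. -}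

module Defs where

open import Level using (0ℓ)
open import Data.Nat as ℕ using (ℕ; zero; suc)
open import Data.Fin using (Fin; zero; suc)
open import Data.Fin.Subset using (Subset; _∈_; _∩_; _∪_; ⋃; ⊤; Nonempty; Empty)
open import Data.Vec using (_∷_; [])
open import Data.Bool using (true; false)
open import Data.List using (List; []; _∷_; _++_; take; length; map; foldr)
open import Data.List.Relation.Unary.All using (All)
open import Data.List.Relation.Unary.AllPairs using (AllPairs)
open import Data.Product using (Σ; ∃; _×_; _,_)
open import Relation.Binary.PropositionalEquality using (_≡_; _≢_)
open import Relation.Binary.Core using (Rel)
open import Relation.Binary.Structures using (IsTotalOrder)
open import Algebra.Structures using (IsAbelianGroup)

-- A totally ordered abelian group (translation-invariant total order).
-- ℝ with + and ≤ is an instance; the theorem is stated for every such group.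
record OrderedAbelianGroup : Set₁ where
  infixl 6 _+_
  infix 4 _≤_ _<_
  field
    Carrier        : Set
    _+_            : Carrier → Carrier → Carrier
    0#             : Carrier
    -_             : Carrier → Carrier
    isAbelianGroup : IsAbelianGroup _≡_ _+_ 0# -_
    _≤_            : Rel Carrier 0ℓ
    isTotalOrder   : IsTotalOrder _≡_ _≤_
    +-mono-≤       : ∀ {x y} z → x ≤ y → x + z ≤ y + z

  _<_ : Carrier → Carrier → Set
  x < y = x ≤ y × x ≢ y

module _ (G : OrderedAbelianGroup) where
  open OrderedAbelianGroup G

  weight : ∀ {n} → (Fin n → Carrier) → Subset n → Carrier
  weight {zero}  lam []          = 0#
  weight {suc n} lam (true  ∷ S) = lam zero + weight (λ i → lam (suc i)) S
  weight {suc n} lam (false ∷ S) = 0# + weight (λ i → lam (suc i)) S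

  weightList : ∀ {n} → (Fin n → Carrier) → List (Subset n) → Carrier
  weightList lam σ = foldr (λ C acc → weight lam C + acc) 0# σ

IsOrderedPartition : ∀ {n} → List (Subset n) → Set
IsOrderedPartition σ =
  All Nonempty σ × AllPairs (λ C D → Empty (C ∩ D)) σ × ⋃ σ ≡ ⊤

-- Cover relation σ' ≺ σ in Π^ord_n: σ is obtained from σ' by merging two adjacent blocks.
_⋖_ : ∀ {n} → List (Subset n) → List (Subset n) → Set
σ' ⋖ σ = IsOrderedPartition σ' × IsOrderedPartition σ ×
  Σ (List _) λ pre → Σ _ λ C → Σ _ λ D → Σ (List _) λ suf →
    (σ' ≡ pre ++ C ∷ D ∷ suf) × (σ ≡ pre ++ (C ∪ D) ∷ suf)

InP : (G : OrderedAbelianGroup) → ∀ {n} → (Fin n → OrderedAbelianGroup.Carrier G) →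
      List (Subset n) → Set
InP G lam σ = IsOrderedPartition σ ×
  (∀ j → 1 ℕ.≤ j → j ℕ.≤ length σ → 0# < weightList G lam (take j σ))
  where open OrderedAbelianGroup G

module Submission where

-- Write σ = pre ++ C ∷ suf and σ' = pre ++ {a} ∷ (C - a) ∷ suf, with weights in
-- an arbitrary totally ordered abelian group.  The proof has two independent parts.
--   * Combinatorics (split-covers): replacing a block C of an ordered partition
--     by two nonempty disjoint blocks X, Y with X ∪ Y = C gives an ordered
--     partition covered by the original one.  We use X = {a} and Y = C ─ X,
--     which is nonempty because |C| ≥ 2.
--   * Weights (split-positive): λ is additive on disjoint unions, so λ_X + λ_Y = λ_C
--     and every prefix sum of σ' equals one of σ, except the one ending in {a},
--     namely λ_pre + λ_a.  It is positive (positive-shift): λ_pre ≥ 0, and if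
--     λ_a ≤ 0 then all of C has λ ≤ λ_a ≤ 0, so λ_C ≤ λ_a (heaviest-bound) and
--     λ_pre + λ_a ≥ λ_pre + λ_C > 0.  Prefix sums are tracked with an offset c
--     (the weight of the blocks already passed), which makes the prefix condition
--     split block by block and lets split-positive go by induction on pre.

open import Defs
open import Level using (0ℓ)
import Data.Nat as ℕ
open import Data.Nat.Properties using (<-irrefl)
open import Data.Fin using (Fin; zero; suc)
open import Data.Fin.Subset
  using (Subset; _∈_; _∉_; ⁅_⁆; _-_; _─_; ∣_∣; _⊆_; _∩_; _∪_; ⋃; ⊥; Nonempty; Empty)
open import Data.Fin.Subset.Properties
  using (_∈?_; nonempty?; ⊆-antisym; x∈p∪q⁺; x∈p∪q⁻; x∈p∩q⁺; x∈p∩q⁻; p⊆p∪q; q⊆p∪q; p─q⊆p; x∈p∧x∉q⇒x∈p─q;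
         x∈⁅x⁆; x∈⁅y⁆⇒x≡y; ∣⁅x⁆∣≡1; Empty-unique; ∪-identityʳ; ∪-assoc)
open import Data.Vec using ([]; _∷_; here; there)
open import Data.Bool using (Bool; true; false; _∨_; _∧_)
open import Data.List using (List; []; _∷_; _++_; take; length)
import Data.List.Relation.Unary.All as All
open import Data.List.Relation.Unary.All using (All; _∷_)
open import Data.List.Relation.Unary.All.Properties using (++⁺; ++⁻)
open import Data.List.Relation.Unary.AllPairs using (AllPairs; _∷_)
open import Data.Product using (_×_; _,_; proj₁; proj₂)
open import Data.Sum using (_⊎_; inj₁; inj₂; [_,_]′)
open import Data.Empty using (⊥-elim)
open import Relation.Nullary using (Dec; yes; no)
open import Relation.Binary.PropositionalEquality
  using (_≡_; refl; sym; trans; cong; cong₂; subst; subst₂; module ≡-Reasoning)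
open import Relation.Binary.Structures using (IsTotalOrder)
open import Algebra.Bundles using (CommutativeSemigroup)
open import Algebra.Structures using (IsAbelianGroup)
import Algebra.Properties.CommutativeSemigroup as CommutativeSemigroupProperties
import Relation.Binary.Construct.NonStrictToStrict as NonStrictToStrict

Disjoint : ∀ {n} → Subset n → Subset n → Set
Disjoint X Y = Empty (X ∩ Y)

x∈p─q⇒x∉q : ∀ {n} (p q : Subset n) {x : Fin n} → x ∈ p ─ q → x ∉ q
x∈p─q⇒x∉q (true ∷ p) (false ∷ q) here ()
x∈p─q⇒x∉q (b ∷ p) (true ∷ q) (there x∈p─q) (there x∈q) = x∈p─q⇒x∉q p q x∈p─q x∈q
x∈p─q⇒x∉q (b ∷ p) (false ∷ q) (there x∈p─q) (there x∈q) = x∈p─q⇒x∉q p q x∈p─q x∈q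

∪-─-cancel : ∀ {n} {X C : Subset n} → X ⊆ C → X ∪ (C ─ X) ≡ C
∪-─-cancel {X = X} {C} X⊆C = ⊆-antisym
  (λ x∈ → [ X⊆C , p─q⊆p C X ]′ (x∈p∪q⁻ X (C ─ X) x∈))
  (λ {x} x∈C → x∈p∪q⁺ (case (x ∈? X) x∈C))
  where
  case : ∀ {x} → Dec (x ∈ X) → x ∈ C → x ∈ X ⊎ x ∈ C ─ X
  case (yes x∈X) _   = inj₁ x∈X
  case (no  x∉X) x∈C = inj₂ (x∈p∧x∉q⇒x∈p─q x∈C x∉X)

─-disjoint : ∀ {n} (X C : Subset n) → Disjoint X (C ─ X)
─-disjoint X C (x , x∈X∩C─X) with x∈p∩q⁻ X (C ─ X) x∈X∩C─X
... | x∈X , x∈C─X = x∈p─q⇒x∉q C X x∈C─X x∈X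

─-nonempty : ∀ {n} {X C : Subset n} → X ⊆ C → ∣ X ∣ ℕ.< ∣ C ∣ → Nonempty (C ─ X)
─-nonempty {X = X} {C} X⊆C ∣X∣<∣C∣ with nonempty? (C ─ X)
... | yes nonempty = nonempty
... | no  empty    = ⊥-elim (<-irrefl (cong ∣_∣ X≡C) ∣X∣<∣C∣)
  where
  X≡C : X ≡ C
  X≡C = begin
    X              ≡⟨ sym (∪-identityʳ X) ⟩
    X ∪ ⊥          ≡⟨ cong (X ∪_) (sym (Empty-unique empty)) ⟩
    X ∪ (C ─ X)    ≡⟨ ∪-─-cancel X⊆C ⟩
    C              ∎
    where open ≡-Reasoning

⁅⁆⊆ : ∀ {n} {a : Fin n} {C : Subset n} → a ∈ C → ⁅ a ⁆ ⊆ C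
⁅⁆⊆ {a = a} a∈C x∈⁅a⁆ = subst (_∈ _) (sym (x∈⁅y⁆⇒x≡y a x∈⁅a⁆)) a∈C

disjoint-monoˡ : ∀ {n} {X C D : Subset n} → X ⊆ C → Disjoint C D → Disjoint X D
disjoint-monoˡ {X = X} {D = D} X⊆C C∩D=∅ (x , x∈X∩D) with x∈p∩q⁻ X D x∈X∩D
... | x∈X , x∈D = C∩D=∅ (x , x∈p∩q⁺ (X⊆C x∈X , x∈D))

disjoint-monoʳ : ∀ {n} {X C D : Subset n} → X ⊆ C → Disjoint D C → Disjoint D X
disjoint-monoʳ {X = X} {D = D} X⊆C D∩C=∅ (x , x∈D∩X) with x∈p∩q⁻ D X x∈D∩X
... | x∈D , x∈X = D∩C=∅ (x , x∈p∩q⁺ (x∈D , X⊆C x∈X))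

split-disjoint : ∀ {n} (pre : List (Subset n)) {C X Y : Subset n} {suf} →
  X ⊆ C → Y ⊆ C → Disjoint X Y →
  AllPairs Disjoint (pre ++ C ∷ suf) → AllPairs Disjoint (pre ++ X ∷ Y ∷ suf)
split-disjoint [] X⊆C Y⊆C X∩Y=∅ (C-vs-suf ∷ rest) =
  (X∩Y=∅ ∷ All.map (disjoint-monoˡ X⊆C) C-vs-suf) ∷ All.map (disjoint-monoˡ Y⊆C) C-vs-suf ∷ rest
split-disjoint (D ∷ pre) X⊆C Y⊆C X∩Y=∅ (D-vs-rest ∷ rest) with ++⁻ pre D-vs-rest
... | D-vs-pre , D-vs-C ∷ D-vs-suf =
  ++⁺ D-vs-pre (disjoint-monoʳ X⊆C D-vs-C ∷ disjoint-monoʳ Y⊆C D-vs-C ∷ D-vs-suf)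
  ∷ split-disjoint pre X⊆C Y⊆C X∩Y=∅ rest

split-nonempty : ∀ {n} (pre : List (Subset n)) {C X Y : Subset n} {suf} →
  Nonempty X → Nonempty Y → All Nonempty (pre ++ C ∷ suf) → All Nonempty (pre ++ X ∷ Y ∷ suf)
split-nonempty pre neX neY all with ++⁻ pre all
... | nePre , _ ∷ neSuf = ++⁺ nePre (neX ∷ neY ∷ neSuf)

split-⋃ : ∀ {n} (pre : List (Subset n)) X Y suf → ⋃ (pre ++ X ∷ Y ∷ suf) ≡ ⋃ (pre ++ (X ∪ Y) ∷ suf)
split-⋃ []        X Y suf = sym (∪-assoc X Y (⋃ suf))
split-⋃ (D ∷ pre) X Y suf = cong (D ∪_) (split-⋃ pre X Y suf)

split-covers : ∀ {n} {pre suf : List (Subset n)} {C X Y : Subset n} →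
  IsOrderedPartition (pre ++ C ∷ suf) → Nonempty X → Nonempty Y → Disjoint X Y → X ∪ Y ≡ C →
  (pre ++ X ∷ Y ∷ suf) ⋖ (pre ++ C ∷ suf)
split-covers {pre = pre} {suf} {C} {X} {Y} σ@(allNonempty , allDisjoint , ⋃σ≡⊤) neX neY X∩Y=∅ X∪Y≡C =
  ( ( split-nonempty pre neX neY allNonempty
    , split-disjoint pre (subst (X ⊆_) X∪Y≡C (p⊆p∪q Y)) (subst (Y ⊆_) X∪Y≡C (q⊆p∪q X Y))
                     X∩Y=∅ allDisjoint
    , trans (split-⋃ pre X Y suf) (trans (cong (λ Z → ⋃ (pre ++ Z ∷ suf)) X∪Y≡C) ⋃σ≡⊤))
  , σ , pre , X , Y , suf , refl , cong (λ Z → pre ++ Z ∷ suf) (sym X∪Y≡C))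

module OrderedGroupProperties (G : OrderedAbelianGroup) where
  open OrderedAbelianGroup G
  open IsAbelianGroup isAbelianGroup public using (assoc; comm; identityˡ; identityʳ)
  open IsTotalOrder isTotalOrder using (total; antisym; ≤-respʳ-≈)
  open IsTotalOrder isTotalOrder public using () renaming (refl to ≤-refl; trans to ≤-trans)

  commutativeSemigroup : CommutativeSemigroup 0ℓ 0ℓ
  commutativeSemigroup = record
    { isCommutativeSemigroup = IsAbelianGroup.isCommutativeSemigroup isAbelianGroup }

  open CommutativeSemigroupProperties commutativeSemigroup public using (interchange)

  -- Defs' strict order x < y is x ≤ y ∧ x ≢ y, the generic strict order of ≤.
  <-≤-trans : ∀ {x y z} → x < y → y ≤ z → x < z
  <-≤-trans = NonStrictToStrict.<-≤-trans _≡_ _≤_ sym ≤-trans antisym ≤-respʳ-≈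

  +-monoʳ-≤ : ∀ {x y} z → x ≤ y → z + x ≤ z + y
  +-monoʳ-≤ {x} {y} z x≤y = subst₂ _≤_ (comm x z) (comm y z) (+-mono-≤ z x≤y)

  +-nonpos-≤ : ∀ x {y} → y ≤ 0# → x + y ≤ x
  +-nonpos-≤ x {y} y≤0 = subst (x + y ≤_) (identityʳ x) (+-monoʳ-≤ x y≤0)

  ≤-+-nonneg : ∀ {x} y → 0# ≤ x → y ≤ x + y
  ≤-+-nonneg {x} y 0≤x = subst (_≤ x + y) (identityˡ y) (+-mono-≤ y 0≤x)

  +-nonpos : ∀ {x y} → x ≤ 0# → y ≤ 0# → x + y ≤ 0#
  +-nonpos {x} x≤0 y≤0 = ≤-trans (+-nonpos-≤ x y≤0) x≤0

  -- If c ≥ 0 and c + t > 0, and t ≤ s whenever s ≤ 0,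
  -- then c + s > 0: for s ≤ 0 use c + s ≥ c + t; for s ≥ 0 the sum c + s
  -- is nonnegative, and it cannot vanish since then s ≤ c + s = 0.
  positive-shift : ∀ {c t s} → 0# ≤ c → 0# < c + t → (s ≤ 0# → t ≤ s) → 0# < c + s
  positive-shift {c} {t} {s} 0≤c 0<c+t s≤0⇒t≤s = by-sign (total s 0#)
    where
    when-nonpos : s ≤ 0# → 0# < c + s
    when-nonpos s≤0 = <-≤-trans 0<c+t (+-monoʳ-≤ c (s≤0⇒t≤s s≤0))
    by-sign : s ≤ 0# ⊎ 0# ≤ s → 0# < c + s
    by-sign (inj₁ s≤0) = when-nonpos s≤0
    by-sign (inj₂ 0≤s) = ≤-trans 0≤s s≤c+s , λ 0≡c+s →
      proj₂ (when-nonpos (subst (s ≤_) (sym 0≡c+s) s≤c+s)) 0≡c+s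
      where
      s≤c+s : s ≤ c + s
      s≤c+s = ≤-+-nonneg s 0≤c

module Weights (G : OrderedAbelianGroup) where
  open OrderedAbelianGroup G
  open OrderedGroupProperties G

  shift : ∀ {n} → (Fin (ℕ.suc n) → Carrier) → Fin n → Carrier
  shift lam i = lam (suc i)

  bitWeight : Carrier → Bool → Carrier
  bitWeight x true  = x
  bitWeight x false = 0#

  weight-∷ : ∀ {n} (lam : Fin (ℕ.suc n) → Carrier) b (S : Subset n) →
             weight G lam (b ∷ S) ≡ bitWeight (lam zero) b + weight G (shift lam) S
  weight-∷ lam true  S = refl
  weight-∷ lam false S = refl

  bitWeight-∨-∧ : ∀ x b c → bitWeight x (b ∨ c) + bitWeight x (b ∧ c) ≡ bitWeight x b + bitWeight x c
  bitWeight-∨-∧ x true  c     = refl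
  bitWeight-∨-∧ x false true  = comm x 0#
  bitWeight-∨-∧ x false false = refl

  weight-⊥ : ∀ {n} (lam : Fin n → Carrier) → weight G lam ⊥ ≡ 0#
  weight-⊥ {ℕ.zero}  lam = refl
  weight-⊥ {ℕ.suc n} lam = trans (cong (0# +_) (weight-⊥ (shift lam))) (identityˡ 0#)

  weight-⁅⁆ : ∀ {n} (lam : Fin n → Carrier) a → weight G lam ⁅ a ⁆ ≡ lam a
  weight-⁅⁆ lam zero    = trans (cong (lam zero +_) (weight-⊥ (shift lam))) (identityʳ (lam zero))
  weight-⁅⁆ lam (suc a) = trans (identityˡ _) (weight-⁅⁆ (shift lam) a)

  weight-∪-∩ : ∀ {n} (lam : Fin n → Carrier) (X Y : Subset n) →
               weight G lam (X ∪ Y) + weight G lam (X ∩ Y) ≡ weight G lam X + weight G lam Y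
  weight-∪-∩ lam [] [] = refl
  weight-∪-∩ lam (b ∷ X) (c ∷ Y) = begin
    weight G lam ((b ∨ c) ∷ X ∪ Y) + weight G lam ((b ∧ c) ∷ X ∩ Y)
      ≡⟨ cong₂ _+_ (weight-∷ lam (b ∨ c) (X ∪ Y)) (weight-∷ lam (b ∧ c) (X ∩ Y)) ⟩
    (β (b ∨ c) + W (X ∪ Y)) + (β (b ∧ c) + W (X ∩ Y))
      ≡⟨ interchange _ _ _ _ ⟩
    (β (b ∨ c) + β (b ∧ c)) + (W (X ∪ Y) + W (X ∩ Y))
      ≡⟨ cong₂ _+_ (bitWeight-∨-∧ (lam zero) b c) (weight-∪-∩ (shift lam) X Y) ⟩
    (β b + β c) + (W X + W Y)
      ≡⟨ interchange _ _ _ _ ⟩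
    (β b + W X) + (β c + W Y)
      ≡⟨ sym (cong₂ _+_ (weight-∷ lam b X) (weight-∷ lam c Y)) ⟩
    weight G lam (b ∷ X) + weight G lam (c ∷ Y) ∎
    where
    open ≡-Reasoning
    β : Bool → Carrier
    β = bitWeight (lam zero)
    W : Subset _ → Carrier
    W = weight G (shift lam)

  weight-disjoint-∪ : ∀ {n} (lam : Fin n → Carrier) {X Y : Subset n} → Disjoint X Y →
                      weight G lam (X ∪ Y) ≡ weight G lam X + weight G lam Y
  weight-disjoint-∪ lam {X} {Y} X∩Y=∅ = begin
    weight G lam (X ∪ Y)                         ≡⟨ sym (identityʳ _) ⟩
    weight G lam (X ∪ Y) + 0#                    ≡⟨ cong (weight G lam (X ∪ Y) +_) (sym (weight-⊥ lam)) ⟩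
    weight G lam (X ∪ Y) + weight G lam ⊥        ≡⟨ cong (λ Z → weight G lam (X ∪ Y) + weight G lam Z)
                                                         (sym (Empty-unique X∩Y=∅)) ⟩
    weight G lam (X ∪ Y) + weight G lam (X ∩ Y)  ≡⟨ weight-∪-∩ lam X Y ⟩
    weight G lam X + weight G lam Y              ∎
    where open ≡-Reasoning

  weight-nonpos : ∀ {n} (lam : Fin n → Carrier) (T : Subset n) →
                  (∀ b → b ∈ T → lam b ≤ 0#) → weight G lam T ≤ 0#
  weight-nonpos lam [] _ = ≤-refl
  weight-nonpos lam (true ∷ T) T≤0 =
    +-nonpos (T≤0 zero here) (weight-nonpos (shift lam) T (λ b b∈T → T≤0 (suc b) (there b∈T)))
  weight-nonpos lam (false ∷ T) T≤0 =
    +-nonpos ≤-refl (weight-nonpos (shift lam) T (λ b b∈T → T≤0 (suc b) (there b∈T)))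

  weight-split : ∀ {n} (lam : Fin n → Carrier) {X C : Subset n} → X ⊆ C →
                 weight G lam X + weight G lam (C ─ X) ≡ weight G lam C
  weight-split lam {X} {C} X⊆C =
    trans (sym (weight-disjoint-∪ lam (─-disjoint X C))) (cong (weight G lam) (∪-─-cancel X⊆C))

  -- If a is a heaviest element of C and λ_a ≤ 0, then λ_C ≤ λ_a:
  -- the remaining elements all weigh at most λ_a ≤ 0.
  heaviest-bound : ∀ {n} (lam : Fin n → Carrier) {C : Subset n} {a : Fin n} → a ∈ C →
                   (∀ b → b ∈ C → lam b ≤ lam a) → lam a ≤ 0# → weight G lam C ≤ lam a
  heaviest-bound lam {C} {a} a∈C a-heaviest λa≤0 =
    subst₂ _≤_ λ[a]+λ[C-a]≡λC refl (+-nonpos-≤ (lam a) λ[C-a]≤0)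
    where
    λ[a]+λ[C-a]≡λC : lam a + weight G lam (C - a) ≡ weight G lam C
    λ[a]+λ[C-a]≡λC = trans (cong (_+ weight G lam (C - a)) (sym (weight-⁅⁆ lam a)))
                           (weight-split lam (⁅⁆⊆ a∈C))
    λ[C-a]≤0 : weight G lam (C - a) ≤ 0#
    λ[C-a]≤0 = weight-nonpos lam (C - a)
      (λ b b∈C-a → ≤-trans (a-heaviest b (p─q⊆p C ⁅ a ⁆ b∈C-a)) λa≤0)

-- The offset c makes the condition
-- compositional: it splits into the first block and the rest of the list.
module Prefixes (G : OrderedAbelianGroup) {n} (lam : Fin n → OrderedAbelianGroup.Carrier G) where
  open OrderedAbelianGroup G
  open OrderedGroupProperties G
  open ≡-Reasoning

  λ[_] : Subset n → Carrier
  λ[ S ] = weight G lam S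

  PositiveFrom : Carrier → List (Subset n) → Set
  PositiveFrom c σ = ∀ j → 1 ℕ.≤ j → j ℕ.≤ length σ → 0# < c + weightList G lam (take j σ)

  positive-∷ : ∀ {c D σ} → 0# < c + λ[ D ] → PositiveFrom (c + λ[ D ]) σ → PositiveFrom c (D ∷ σ)
  positive-∷ {c} {D} first _ 1 _ _ = subst (λ x → 0# < c + x) (sym (identityʳ λ[ D ])) first
  positive-∷ {c} {D} _ rest (ℕ.suc (ℕ.suc j)) _ (ℕ.s≤s j<len) =
    subst (0# <_) (assoc c λ[ D ] _) (rest (ℕ.suc j) (ℕ.s≤s ℕ.z≤n) j<len)

  positive-head : ∀ {c D σ} → PositiveFrom c (D ∷ σ) → 0# < c + λ[ D ]
  positive-head {c} {D} positive =
    subst (λ x → 0# < c + x) (identityʳ λ[ D ]) (positive 1 (ℕ.s≤s ℕ.z≤n) (ℕ.s≤s ℕ.z≤n))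

  positive-tail : ∀ {c D σ} → PositiveFrom c (D ∷ σ) → PositiveFrom (c + λ[ D ]) σ
  positive-tail {c} {D} positive (ℕ.suc j) _ j≤len =
    subst (0# <_) (sym (assoc c λ[ D ] _)) (positive (ℕ.suc (ℕ.suc j)) (ℕ.s≤s ℕ.z≤n) (ℕ.s≤s j≤len))

  positive-from-0 : ∀ {σ} → (∀ j → 1 ℕ.≤ j → j ℕ.≤ length σ → 0# < weightList G lam (take j σ)) →
                    PositiveFrom 0# σ
  positive-from-0 positive j 1≤j j≤len = subst (0# <_) (sym (identityˡ _)) (positive j 1≤j j≤len)

  positive-to-0 : ∀ {σ} → PositiveFrom 0# σ →
                  (∀ j → 1 ℕ.≤ j → j ℕ.≤ length σ → 0# < weightList G lam (take j σ))
  positive-to-0 positive j 1≤j j≤len = subst (0# <_) (identityˡ _) (positive j 1≤j j≤len)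

  -- The offset stays nonnegative while
  -- passing the blocks before C, since their prefix sums are positive.
  split-positive : ∀ (pre : List (Subset n)) {C X Y : Subset n} {suf c} →
    λ[ X ] + λ[ Y ] ≡ λ[ C ] →
    (∀ {c} → 0# ≤ c → 0# < c + λ[ C ] → 0# < c + λ[ X ]) →
    0# ≤ c → PositiveFrom c (pre ++ C ∷ suf) → PositiveFrom c (pre ++ X ∷ Y ∷ suf)
  split-positive [] {C} {X} {Y} {suf} {c} λX+λY≡λC first-part 0≤c positive =
    positive-∷ (first-part 0≤c (positive-head positive))
      (positive-∷ (subst (0# <_) (sym offset-after-Y) (positive-head positive))
                  (subst (λ x → PositiveFrom x suf) (sym offset-after-Y) (positive-tail positive)))
    where
    offset-after-Y : (c + λ[ X ]) + λ[ Y ] ≡ c + λ[ C ]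
    offset-after-Y = begin
      (c + λ[ X ]) + λ[ Y ]   ≡⟨ assoc c λ[ X ] λ[ Y ] ⟩
      c + (λ[ X ] + λ[ Y ])   ≡⟨ cong (c +_) λX+λY≡λC ⟩
      c + λ[ C ]              ∎
  split-positive (D ∷ pre) λX+λY≡λC first-part 0≤c positive =
    positive-∷ (positive-head positive)
      (split-positive pre λX+λY≡λC first-part (proj₁ (positive-head positive)) (positive-tail positive))

open import Data.Nat using (_≤_)

mainTheorem16 : (G : OrderedAbelianGroup) → (n : _) →
    (lam : Fin n → OrderedAbelianGroup.Carrier G) →
    (σ : List (Subset n)) → InP G lam σ →
    (pre : List (Subset n)) → (Cj : Subset n) → (suf : List (Subset n)) →
    σ ≡ pre ++ Cj ∷ suf →
    2 ≤ ∣ Cj ∣ →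
    (a : Fin n) → a ∈ Cj →
    (∀ b → b ∈ Cj → OrderedAbelianGroup._≤_ G (lam b) (lam a)) →
    ((pre ++ ⁅ a ⁆ ∷ (Cj - a) ∷ suf) ⋖ σ) × InP G lam (pre ++ ⁅ a ⁆ ∷ (Cj - a) ∷ suf)
mainTheorem16 G _ lam .(pre ++ Cj ∷ suf) (σ-partition , σ-positive) pre Cj suf refl 2≤∣Cj∣ a a∈Cj a-heaviest =
  cover , proj₁ cover , positive-to-0 σ'-positive
  where
  open OrderedAbelianGroup G using (0#; _+_; _<_) renaming (_≤_ to _≤ᴳ_)
  open OrderedGroupProperties G using (positive-shift; ≤-refl)
  open Weights G using (weight-⁅⁆; weight-split; heaviest-bound)
  open Prefixes G lam

  ⁅a⁆⊆Cj : ⁅ a ⁆ ⊆ Cj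
  ⁅a⁆⊆Cj = ⁅⁆⊆ a∈Cj

  cover : (pre ++ ⁅ a ⁆ ∷ (Cj - a) ∷ suf) ⋖ (pre ++ Cj ∷ suf)
  cover = split-covers σ-partition (a , x∈⁅x⁆ a)
    (─-nonempty ⁅a⁆⊆Cj (subst (ℕ._< ∣ Cj ∣) (sym (∣⁅x⁆∣≡1 a)) 2≤∣Cj∣))
    (─-disjoint ⁅ a ⁆ Cj) (∪-─-cancel ⁅a⁆⊆Cj)

  first-part : ∀ {c} → 0# ≤ᴳ c → 0# < c + λ[ Cj ] → 0# < c + λ[ ⁅ a ⁆ ]
  first-part 0≤c 0<c+λCj = subst (λ x → 0# < _ + x) (sym (weight-⁅⁆ lam a))
    (positive-shift 0≤c 0<c+λCj (heaviest-bound lam a∈Cj a-heaviest))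

  σ'-positive : PositiveFrom 0# (pre ++ ⁅ a ⁆ ∷ (Cj - a) ∷ suf)
  σ'-positive = split-positive pre (weight-split lam ⁅a⁆⊆Cj) first-part ≤-refl (positive-from-0 σ-positive)
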